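{- Let $a,b,A,B,h,k$ be integers with $b,B,k\ge 1$, $0\le a<b$, $0\le A<B$, $0\le h<k$ and $\gcd(a,b)=\gcd(A,B)=\gcd(h,k)=1$. Put $k':=k/\gcd(k,B)$. Then \[\left(\zeta_b^a\zeta_k^{hA};\zeta_k^{hB}\right)_{\infty}\left(\zeta_b^{ -a}\zeta_k^{h(B-A)};\zeta_k^{hB}\right)_{\infty}=0\] if and only if $b\mid k$ and $\gcd(B,k)\mid\left(\frac{ak}{b}+hA\right)$. Moreover, if this is the case, then for every integer $n\ge 0$ we have $\alpha_n\ge\left\lfloor\frac{2n+2}{k'}\right\rfloor$, where $\alpha_n$ denotes the order of the zero at $q=\zeta_k^h$ of the polynomial $\left(\zeta_b^aq^{A};q^{B}\right)_{n+1}\left(\zeta_b^{ -a}q^{B-A};q^{B}\right)_{n+1}$, equivalently the number of vanishing factors in $\left(\zeta_b^a\zeta_k^{hA};\zeta_k^{hB}\right)_{n+1}\left(\zeta_b^{ -a}\zeta_k^{h(B-A)};\zeta_k^{hB}\right)_{n+1}$.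
   Context: For $x\in\mathbb R$, $e(x):=e^{2\pi i x}$ and $\zeta_m^j:=e(j/m)$. For $n\in\mathbb N_0\cup\{\infty\}$, $(x;q)_n:=\prod_{j=0}^{n-1}(1-xq^j)$ (an infinite product for $n=\infty$, which for $|q|=1$ is understood as the formal product, equal to $0$ iff some factor vanishes). $\lfloor x\rfloor$ is the floor of $x$. -}

module Defs where

open import Data.Nat as ℕ using (ℕ; zero; suc; NonZero; ≢-nonZero; _/_)
open import Data.Nat.GCD using (gcd; gcd[m,n]≢0; m/gcd[m,n]≢0)
open import Data.Nat.Divisibility using (_∣_; _∣?_)
open import Data.Integer as ℤ using (ℤ; +_; ∣_∣)
open import Data.Rational.Unnormalised as Q using (ℚᵘ)
open import Data.Sum using (inj₁)
open import Data.Product using (∃)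
open import Relation.Nullary using (does)
open import Data.Bool using (if_then_else_)

-- We represent the complex number e(x) = exp(2πix), x ∈ ℚ,
-- by its exponent x ∈ ℚᵘ (so e(x)e(y) = e(x+y), e(x)^j = e(jx),
-- e(x)^{-1} = e(-x)).  Equality of roots of unity is equality of exponents mod ℤ.
RootOfUnity : Set
RootOfUnity = ℚᵘ

ζ : (m : ℕ) .{{_ : NonZero m}} → ℤ → RootOfUnity
ζ m j = (j Q./ m)

_·_ : RootOfUnity → RootOfUnity → RootOfUnity
x · y = x Q.+ y

_^ᶻ_ : RootOfUnity → ℤ → RootOfUnity
z ^ᶻ j = (j Q./ 1) Q.* z

-- e(x) = 1  iff  x ∈ ℤ  iff the denominator divides the numerator.
IsOne : RootOfUnity → Set
IsOne x = ℚᵘ.denominatorℕ x ∣ ∣ ℚᵘ.numerator x ∣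

-- j-th factor (1 - x q^j) of (x;q)_∞ vanishes
FactorVanishes : RootOfUnity → RootOfUnity → ℕ → Set
FactorVanishes x q j = IsOne (x · (q ^ᶻ (+ j)))

-- (x;q)_∞ = 0  (formal product: zero iff some factor vanishes)
PochInfZero : RootOfUnity → RootOfUnity → Set
PochInfZero x q = ∃ λ (j : ℕ) → FactorVanishes x q j

vanishingCount : RootOfUnity → RootOfUnity → ℕ → ℕ
vanishingCount x q zero = zero
vanishingCount x q (suc n) =
  (if does (ℚᵘ.denominatorℕ (x · (q ^ᶻ (+ n))) ∣? ∣ ℚᵘ.numerator (x · (q ^ᶻ (+ n))) ∣)
   then 1 else 0) ℕ.+ vanishingCount x q n

gcdNZ : (k B : ℕ) → .{{NonZero k}} → NonZero (gcd k B)
gcdNZ k B = ≢-nonZero (gcd[m,n]≢0 k B (inj₁ (ℕ.≢-nonZero⁻¹ k)))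

kPrime : (k B : ℕ) .{{_ : NonZero k}} → ℕ
kPrime k B = _/_ k (gcd k B) {{gcdNZ k B}}

kPrimeNZ : (k B : ℕ) → .{{_ : NonZero k}} → NonZero (kPrime k B)
kPrimeNZ k B = ≢-nonZero (m/gcd[m,n]≢0 k B)
  where instance _ = gcdNZ k B

_/kPrime[_,_] : ℕ → (k B : ℕ) .{{_ : NonZero k}} → ℕ
m /kPrime[ k , B ] = _/_ m (kPrime k B) {{kPrimeNZ k B}}

{-# OPTIONS --safe #-}
module Submission where

open import Defs
open import Data.Integer as ℤ using (ℤ; +_; -_)
import Data.Integer.Properties as ℤ
open import Data.Integer.Divisibility.Signed as ℤ∣ using () renaming (_∣_ to _∣ℤ_)
import Data.Integer.Tactic.RingSolver as ℤ-Ring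
open import Data.Nat as ℕ
  using (ℕ; zero; suc; NonZero; _<_; _≤_; _≤′_; _+_; _*_; _∸_; _/_; _%_; z≤n; s≤s)
open import Data.Nat.Coprimality as Coprime using (Coprime; gcd≡1⇒coprime; coprime-divisor)
open import Data.Nat.Divisibility
open import Data.Nat.DivMod
open import Data.Nat.GCD
open import Data.Nat.Properties
open import Data.Nat.Tactic.RingSolver using (solve-∀)
open import Data.Product using (_×_; _,_; ∃)
open import Data.Sum using (_⊎_; inj₁; inj₂)
open import Function using (_∘_)
open import Function.Bundles using (_⇔_; mk⇔; Equivalence)
open import Function.Construct.Composition using (_⇔-∘_)
open import Algebra.Properties.CommutativeSemigroup *-commutativeSemigroup using (x∙yz≈y∙xz)
open import Relation.Binary.PropositionalEquality
open import Relation.Nullary using (yes; no)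
open import Relation.Nullary.Decidable using (dec-true)

-- Put x₁ = ζ_b^a ζ_k^{hA}, x₂ = ζ_b^{-a} ζ_k^{h(B-A)} and q = ζ_k^{hB}.  The j-th factor of
-- (x₁;q)_∞ vanishes iff bk ∣ ak + (hA + j·hB)b, which (as gcd(a,b) = 1) means b ∣ k and
-- k ∣ m₁ + j·hB with m₁ = a(k/b) + hA; likewise for (x₂;q)_∞ with m₂ = (b-a)(k/b) + h(B-A),
-- and m₁ + m₂ = k + hB reflects x₁x₂ = q.  Since gcd(h,k) = 1, the congruence
-- m₁ + j·hB ≡ 0 (mod k) is solvable iff gcd(B,k) ∣ m₁, which gives the equivalence.
-- For the count, k ∣ k'·hB, so the zeros of both products are k'-periodic, and a zero r of
-- the first gives the zero k' - 1 - r of the second.  Writing N = s + t k' with s < k', the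
-- first N factors contain at least t zeros of each product, and one more unless both
-- residues are ≥ s, in which case 2s ≤ k' - 1.

+∣+⇔∣ : ∀ {m n} → + m ∣ℤ + n ⇔ m ∣ n
+∣+⇔∣ = mk⇔ ℤ∣.∣⇒∣ᵤ ℤ∣.∣ᵤ⇒∣

∣⇔∣+self : ∀ {d n} → d ∣ℤ n ⇔ d ∣ℤ n ℤ.+ d
∣⇔∣+self = mk⇔ (λ d∣n → ℤ∣.∣m∣n⇒∣m+n d∣n ℤ∣.∣-refl) (λ d∣n+d → ℤ∣.∣m+n∣n⇒∣m d∣n+d ℤ∣.∣-refl)

factorVanishes⇔ : ∀ b k .{{_ : NonZero b}} .{{_ : NonZero k}} (u v w : ℤ) j →
  FactorVanishes (ζ b u · ζ k v) (ζ k w) j ⇔ + (b * k) ∣ℤ u ℤ.* + k ℤ.+ (v ℤ.+ + j ℤ.* w) ℤ.* + b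
factorVanishes⇔ b@(suc _) k@(suc _) u v w j =
  mk⇔ (ℤ∣.*-cancelʳ-∣ (+ k) ∘ subst₂ _∣ℤ_ denominator numerator ∘ ℤ∣.∣ᵤ⇒∣)
      (ℤ∣.∣⇒∣ᵤ ∘ subst₂ _∣ℤ_ (sym denominator) (sym numerator) ∘ ℤ∣.*-monoˡ-∣ (+ k))
  where
  denominator : + (b * k * (1 * k)) ≡ + (b * k) ℤ.* + k
  denominator = trans (cong (λ k′ → + (b * k * k′)) (*-identityˡ k)) (ℤ.pos-* (b * k) k)
  collect : ∀ u v w b k j → (u ℤ.* k ℤ.+ v ℤ.* b) ℤ.* k ℤ.+ (j ℤ.* w) ℤ.* (b ℤ.* k)
                          ≡ (u ℤ.* k ℤ.+ (v ℤ.+ j ℤ.* w) ℤ.* b) ℤ.* k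
  collect = ℤ-Ring.solve-∀
  numerator : (u ℤ.* + k ℤ.+ v ℤ.* + b) ℤ.* + (1 * k) ℤ.+ (+ j ℤ.* w) ℤ.* + (b * k)
            ≡ (u ℤ.* + k ℤ.+ (v ℤ.+ + j ℤ.* w) ℤ.* + b) ℤ.* + k
  numerator = begin
    (u ℤ.* + k ℤ.+ v ℤ.* + b) ℤ.* + (1 * k) ℤ.+ (+ j ℤ.* w) ℤ.* + (b * k)
      ≡⟨ cong₂ (λ k′ bk → (u ℤ.* + k ℤ.+ v ℤ.* + b) ℤ.* + k′ ℤ.+ (+ j ℤ.* w) ℤ.* bk)
               (*-identityˡ k) (ℤ.pos-* b k) ⟩
    (u ℤ.* + k ℤ.+ v ℤ.* + b) ℤ.* + k ℤ.+ (+ j ℤ.* w) ℤ.* (+ b ℤ.* + k)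
      ≡⟨ collect u v w (+ b) (+ k) (+ j) ⟩
    (u ℤ.* + k ℤ.+ (v ℤ.+ + j ℤ.* w) ℤ.* + b) ℤ.* + k ∎
    where open ≡-Reasoning

+∣+a*k+[v+j*w]*b⇔ : ∀ {b k} a v w j →
  + (b * k) ∣ℤ + a ℤ.* + k ℤ.+ (+ v ℤ.+ + j ℤ.* + w) ℤ.* + b ⇔ b * k ∣ a * k + (v + j * w) * b
+∣+a*k+[v+j*w]*b⇔ {b} {k} a v w j =
  subst (λ n → + (b * k) ∣ℤ n ⇔ b * k ∣ a * k + (v + j * w) * b) pos-expr +∣+⇔∣
  where
  open ≡-Reasoning
  pos-expr : + (a * k + (v + j * w) * b) ≡ + a ℤ.* + k ℤ.+ (+ v ℤ.+ + j ℤ.* + w) ℤ.* + b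
  pos-expr = begin
    + (a * k + (v + j * w) * b)               ≡⟨ ℤ.pos-+ (a * k) _ ⟩
    + (a * k) ℤ.+ + ((v + j * w) * b)         ≡⟨ cong₂ ℤ._+_ (ℤ.pos-* a k) (ℤ.pos-* (v + j * w) b) ⟩
    + a ℤ.* + k ℤ.+ + (v + j * w) ℤ.* + b     ≡⟨ cong (λ n → + a ℤ.* + k ℤ.+ n ℤ.* + b)
                                                      (trans (ℤ.pos-+ v (j * w))
                                                             (cong (λ n → + v ℤ.+ n) (ℤ.pos-* j w))) ⟩
    + a ℤ.* + k ℤ.+ (+ v ℤ.+ + j ℤ.* + w) ℤ.* + b ∎

factorVanishes⁺⇔ : ∀ {b k} .{{_ : NonZero b}} .{{_ : NonZero k}} a v w j →
  FactorVanishes (ζ b (+ a) · ζ k (+ v)) (ζ k (+ w)) j ⇔ b * k ∣ a * k + (v + j * w) * b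
factorVanishes⁺⇔ {b} {k} a v w j =
  +∣+a*k+[v+j*w]*b⇔ a v w j ⇔-∘ factorVanishes⇔ b k (+ a) (+ v) (+ w) j

factorVanishes⁻⇔ : ∀ {b k} .{{_ : NonZero b}} .{{_ : NonZero k}} {a} v w j → a ≤ b →
  FactorVanishes (ζ b (- + a) · ζ k (+ v)) (ζ k (+ w)) j ⇔ b * k ∣ (b ∸ a) * k + (v + j * w) * b
factorVanishes⁻⇔ {b} {k} {a} v w j a≤b =
  +∣+a*k+[v+j*w]*b⇔ (b ∸ a) v w j
    ⇔-∘ (subst (λ n → + (b * k) ∣ℤ - + a ℤ.* + k ℤ.+ y ℤ.* + b ⇔ + (b * k) ∣ℤ n) add-b*k ∣⇔∣+self
    ⇔-∘ factorVanishes⇔ b k (- + a) (+ v) (+ w) j)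
  where
  open ≡-Reasoning
  y = + v ℤ.+ + j ℤ.* + w
  shift : ∀ u y b k → u ℤ.* k ℤ.+ y ℤ.* b ℤ.+ b ℤ.* k ≡ (b ℤ.+ u) ℤ.* k ℤ.+ y ℤ.* b
  shift = ℤ-Ring.solve-∀
  add-b*k : - + a ℤ.* + k ℤ.+ y ℤ.* + b ℤ.+ + (b * k) ≡ + (b ∸ a) ℤ.* + k ℤ.+ y ℤ.* + b
  add-b*k = begin
    - + a ℤ.* + k ℤ.+ y ℤ.* + b ℤ.+ + (b * k)    ≡⟨ cong (λ n → - + a ℤ.* + k ℤ.+ y ℤ.* + b ℤ.+ n)
                                                         (ℤ.pos-* b k) ⟩
    - + a ℤ.* + k ℤ.+ y ℤ.* + b ℤ.+ + b ℤ.* + k  ≡⟨ shift (- + a) y (+ b) (+ k) ⟩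
    (+ b ℤ.+ - + a) ℤ.* + k ℤ.+ y ℤ.* + b        ≡⟨ cong (λ n → n ℤ.* + k ℤ.+ y ℤ.* + b)
                                                         (trans (ℤ.m-n≡m⊖n b a) (ℤ.⊖-≥ a≤b)) ⟩
    + (b ∸ a) ℤ.* + k ℤ.+ y ℤ.* + b              ∎

coprime-∸ˡ : ∀ {a b} → a ≤ b → Coprime a b → Coprime (b ∸ a) b
coprime-∸ˡ {a} {b} a≤b a⊥b (i∣b∸a , i∣b) =
  a⊥b (∣m+n∣m⇒∣n (subst (_ ∣_) (sym (m∸n+n≡m a≤b)) i∣b) i∣b∸a , i∣b)

b*k∣a*k+x*b⇔k∣a*[k/b]+x : ∀ {a b} k x .{{_ : NonZero b}} → Coprime a b →
  b * k ∣ a * k + x * b ⇔ (b ∣ k × k ∣ a * (k / b) + x)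
b*k∣a*k+x*b⇔k∣a*[k/b]+x {a} {b} k x a⊥b = mk⇔ to from
  where
  factor : b ∣ k → a * k + x * b ≡ b * (a * (k / b) + x)
  factor b∣k = begin
    a * k + x * b              ≡⟨ cong (λ n → a * n + x * b) (sym (m/n*n≡m b∣k)) ⟩
    a * (k / b * b) + x * b    ≡⟨ distrib a b x (k / b) ⟩
    b * (a * (k / b) + x)      ∎
    where
    open ≡-Reasoning
    distrib : ∀ a b x c → a * (c * b) + x * b ≡ b * (a * c + x)
    distrib = solve-∀
  to : b * k ∣ a * k + x * b → b ∣ k × k ∣ a * (k / b) + x
  to d = b∣k , *-cancelˡ-∣ b (subst (b * k ∣_) (factor b∣k) d)
    where
    b∣a*k : b ∣ a * k
    b∣a*k = ∣m+n∣m⇒∣n (subst (b ∣_) (+-comm (a * k) (x * b)) (∣-trans (m∣m*n k) d)) (n∣m*n x)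
    b∣k = coprime-divisor (Coprime.sym a⊥b) b∣a*k
  from : b ∣ k × k ∣ a * (k / b) + x → b * k ∣ a * k + x * b
  from (b∣k , d) = subst (b * k ∣_) (sym (factor b∣k)) (*-monoʳ-∣ b d)

∣m+j*d⇒∣m : ∀ {g k d} m j → g ∣ k → g ∣ d → k ∣ m + j * d → g ∣ m
∣m+j*d⇒∣m {g} m j g∣k g∣d k∣m+j*d =
  ∣m+n∣m⇒∣n (subst (g ∣_) (+-comm m _) (∣-trans g∣k k∣m+j*d)) (∣n⇒∣m*n j g∣d)

solveCongruence-gcd : ∀ d k .{{_ : NonZero k}} → ∃ λ j → k ∣ gcd d k + j * d
solveCongruence-gcd d k@(suc k-1) with Bézout.identity (gcd-GCD d k)
... | Bézout.-+ x y eq = x , divides y eq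
... | Bézout.+- x y eq = x * k-1 , divides (g + k-1 * y) (begin
  g + x * k-1 * d            ≡⟨ cong (λ n → g + n) (reassoc x k-1 d) ⟩
  g + k-1 * (x * d)          ≡⟨ cong (λ n → g + k-1 * n) (sym eq) ⟩
  g + k-1 * (g + y * k)      ≡⟨ collect g k-1 y ⟩
  (g + k-1 * y) * k          ∎)
  where
  open ≡-Reasoning
  g = gcd d k
  reassoc : ∀ x c d → x * c * d ≡ c * (x * d)
  reassoc = solve-∀
  collect : ∀ g c y → g + c * (g + y * suc c) ≡ (g + c * y) * suc c
  collect = solve-∀

solveCongruence : ∀ {d k m} .{{_ : NonZero k}} → gcd d k ∣ m → ∃ λ j → k ∣ m + j * d
solveCongruence {d} {k} (divides-refl c) with solveCongruence-gcd d k
... | j , k∣g+j*d = c * j , subst (k ∣_) (scale c (gcd d k) j d) (∣n⇒∣m*n c k∣g+j*d)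
  where
  scale : ∀ c g j d → c * (g + j * d) ≡ c * g + c * j * d
  scale = solve-∀

coprime⇒gcd[h*B,k]∣gcd[B,k] : ∀ h B {k} → Coprime h k → gcd (h * B) k ∣ gcd B k
coprime⇒gcd[h*B,k]∣gcd[B,k] h B {k} h⊥k = gcd-greatest g∣B (gcd[m,n]∣n (h * B) k)
  where
  g⊥h : Coprime (gcd (h * B) k) h
  g⊥h (i∣g , i∣h) = h⊥k (i∣h , ∣-trans i∣g (gcd[m,n]∣n (h * B) k))
  g∣B : gcd (h * B) k ∣ B
  g∣B = coprime-divisor g⊥h (gcd[m,n]∣m (h * B) k)

∣m+i*d⇒∣m+[i+p]*d : ∀ {k m d p} i → k ∣ p * d → k ∣ m + i * d → k ∣ m + (i + p) * d
∣m+i*d⇒∣m+[i+p]*d {k} {m} {d} {p} i k∣p*d k∣m+i*d =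
  subst (k ∣_) (distrib m i p d) (∣m∣n⇒∣m+n k∣m+i*d k∣p*d)
  where
  distrib : ∀ m i p d → m + i * d + p * d ≡ m + (i + p) * d
  distrib = solve-∀

∣m+i*d⇒∣m+[i%p]*d : ∀ {k m d p} .{{_ : NonZero p}} i →
  k ∣ p * d → k ∣ m + i * d → k ∣ m + (i % p) * d
∣m+i*d⇒∣m+[i%p]*d {k} {m} {d} {p} i k∣p*d k∣m+i*d =
  ∣m+n∣m⇒∣n (subst (k ∣_) split k∣m+i*d) (∣n⇒∣m*n (i / p) k∣p*d)
  where
  open ≡-Reasoning
  regroup : ∀ m s t p d → m + (s + t * p) * d ≡ t * (p * d) + (m + s * d)
  regroup = solve-∀
  split : m + i * d ≡ i / p * (p * d) + (m + i % p * d)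
  split = begin
    m + i * d                          ≡⟨ cong (λ n → m + n * d) (m≡m%n+[m/n]*n i p) ⟩
    m + (i % p + i / p * p) * d        ≡⟨ regroup m (i % p) (i / p) p d ⟩
    i / p * (p * d) + (m + i % p * d)  ∎

∣m+r*d⇒∣m′+s*d : ∀ {k m m′ d p r s} → m + m′ ≡ k + d → k ∣ p * d → suc (r + s) ≡ p →
  k ∣ m + r * d → k ∣ m′ + s * d
∣m+r*d⇒∣m′+s*d {k} {m} {m′} {d} {p} {r} {s} m+m′≡k+d k∣p*d 1+r+s≡p k∣m+r*d =
  ∣m+n∣m⇒∣n (subst (k ∣_) (sym sum) (∣m∣n⇒∣m+n ∣-refl k∣p*d)) k∣m+r*d
  where
  open ≡-Reasoning
  regroup : ∀ m m′ r s d → m + r * d + (m′ + s * d) ≡ m + m′ + (r + s) * d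
  regroup = solve-∀
  absorb : ∀ k d n → k + d + n * d ≡ k + suc n * d
  absorb = solve-∀
  sum : m + r * d + (m′ + s * d) ≡ k + p * d
  sum = begin
    m + r * d + (m′ + s * d)  ≡⟨ regroup m m′ r s d ⟩
    m + m′ + (r + s) * d      ≡⟨ cong (λ n → n + (r + s) * d) m+m′≡k+d ⟩
    k + d + (r + s) * d       ≡⟨ absorb k d (r + s) ⟩
    k + suc (r + s) * d       ≡⟨ cong (λ n → k + n * d) 1+r+s≡p ⟩
    k + p * d                 ∎

k∣kPrime*B : ∀ k B .{{_ : NonZero k}} → k ∣ kPrime k B * B
k∣kPrime*B k B = subst (k ∣_) (sym swap) (m∣m*n (B / g))
  where
  instance _ = gcdNZ k B
  g = gcd k B
  open ≡-Reasoning
  swap : k / g * B ≡ k * (B / g)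
  swap = begin
    k / g * B       ≡⟨ *-comm (k / g) B ⟩
    B * (k / g)     ≡⟨ sym (*-/-assoc B (gcd[m,n]∣m k B)) ⟩
    B * k / g       ≡⟨ cong (_/ g) (*-comm B k) ⟩
    k * B / g       ≡⟨ *-/-assoc k (gcd[m,n]∣n k B) ⟩
    k * (B / g)     ∎

module _ {x q : RootOfUnity} where

  vanishingCount-mono : ∀ {m n} → m ≤ n → vanishingCount x q m ≤ vanishingCount x q n
  vanishingCount-mono = mono′ ∘ ≤⇒≤′
    where
    mono′ : ∀ {m n} → m ≤′ n → vanishingCount x q m ≤ vanishingCount x q n
    mono′ ℕ.≤′-refl = ≤-refl
    mono′ (ℕ.≤′-step m≤′n) = ≤-trans (mono′ m≤′n) (m≤n+m _ _)

  vanishingCount-suc : ∀ {i} → FactorVanishes x q i →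
    vanishingCount x q (suc i) ≡ suc (vanishingCount x q i)
  vanishingCount-suc {i} fv rewrite dec-true (_ ∣? _) fv = refl

  vanishingCount-hit : ∀ {i n} → FactorVanishes x q i → i < n →
    suc (vanishingCount x q i) ≤ vanishingCount x q n
  vanishingCount-hit {n = n} fv i<n =
    subst (_≤ vanishingCount x q n) (vanishingCount-suc fv) (vanishingCount-mono i<n)

module _ {x q : RootOfUnity} {p : ℕ} .{{_ : NonZero p}}
         (periodic : ∀ i → FactorVanishes x q i → FactorVanishes x q (i + p))
         {r : ℕ} (hit : FactorVanishes x q r) where

  vanishes-r+t*p : ∀ t → FactorVanishes x q (r + t * p)
  vanishes-r+t*p zero = subst (FactorVanishes x q) (sym (+-identityʳ r)) hit
  vanishes-r+t*p (suc t) =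
    subst (FactorVanishes x q) (trans (+-assoc r (t * p) p) (cong (λ n → r + n) (+-comm (t * p) p)))
          (periodic _ (vanishes-r+t*p t))

  vanishingCount-≥ : ∀ t {N} → r + t * p < N → suc t ≤ vanishingCount x q N
  vanishingCount-≥ zero lt = ≤-trans (s≤s z≤n) (vanishingCount-hit (vanishes-r+t*p zero) lt)
  vanishingCount-≥ (suc t) lt =
    ≤-trans (s≤s (vanishingCount-≥ t (+-monoʳ-< r (m<n+m (t * p) (ℕ.>-nonZero⁻¹ p)))))
            (vanishingCount-hit (vanishes-r+t*p (suc t)) lt)

  vanishingCount-≥′ : ∀ t {N} → r < p → t * p ≤ N → t ≤ vanishingCount x q N
  vanishingCount-≥′ zero r<p _ = z≤n
  vanishingCount-≥′ (suc t) r<p t*p≤N = vanishingCount-≥ t (<-≤-trans (+-monoˡ-< (t * p) r<p) t*p≤N)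

vanishingCount-pair-≥ : ∀ {x₁ x₂ q : RootOfUnity} {p} .{{_ : NonZero p}} →
  (∀ i → FactorVanishes x₁ q i → FactorVanishes x₁ q (i + p)) →
  (∀ i → FactorVanishes x₂ q i → FactorVanishes x₂ q (i + p)) →
  ∀ {r₁ r₂} → FactorVanishes x₁ q r₁ → FactorVanishes x₂ q r₂ → suc (r₁ + r₂) ≡ p →
  ∀ N → (2 * N) / p ≤ vanishingCount x₁ q N + vanishingCount x₂ q N
vanishingCount-pair-≥ {x₁} {x₂} {q} {p} per₁ per₂ {r₁} {r₂} hit₁ hit₂ 1+r₁+r₂≡p N =
  ≤-pred (m<n*o⇒m/o<n (subst (λ N → 2 * N < suc (S N) * p) (sym (m≡m%n+[m/n]*n N p))
                                (bound (N % p) (N / p) (m%n<n N p))))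
  where
  S : ℕ → ℕ
  S N = vanishingCount x₁ q N + vanishingCount x₂ q N

  r₁<p : r₁ < p
  r₁<p = <-≤-trans (s≤s (m≤m+n r₁ r₂)) (≤-reflexive 1+r₁+r₂≡p)
  r₂<p : r₂ < p
  r₂<p = <-≤-trans (s≤s (m≤n+m r₂ r₁)) (≤-reflexive 1+r₁+r₂≡p)

  widen : ∀ {s t} e → 2 * s < suc e * p → e + (t + t) ≤ S (s + t * p) →
          2 * (s + t * p) < suc (S (s + t * p)) * p
  widen {s} {t} e 2s<[1+e]p e+2t≤S = begin-strict
    2 * (s + t * p)          ≡⟨ distrib s t p ⟩
    2 * s + (t + t) * p      <⟨ +-monoˡ-< ((t + t) * p) 2s<[1+e]p ⟩
    suc e * p + (t + t) * p  ≡⟨ *-distribʳ-+ p (suc e) (t + t) ⟨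
    suc (e + (t + t)) * p    ≤⟨ *-monoˡ-≤ p (s≤s e+2t≤S) ⟩
    suc (S (s + t * p)) * p  ∎
    where
    open ≤-Reasoning
    distrib : ∀ s t p → 2 * (s + t * p) ≡ 2 * s + (t + t) * p
    distrib = solve-∀

  bound : ∀ s t → s < p → 2 * (s + t * p) < suc (S (s + t * p)) * p
  bound s t s<p with r₁ <? s | r₂ <? s
  ... | yes r₁<s | _ = widen {s} {t} 1 (*-monoʳ-< 2 s<p)
        (+-mono-≤ (vanishingCount-≥ {x₁} {q} per₁ hit₁ t (+-monoˡ-< (t * p) r₁<s))
                  (vanishingCount-≥′ {x₂} {q} per₂ hit₂ t r₂<p (m≤n+m (t * p) s)))
  ... | no _ | yes r₂<s = widen {s} {t} 1 (*-monoʳ-< 2 s<p)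
        (subst (_≤ S (s + t * p)) (+-suc t t)
          (+-mono-≤ (vanishingCount-≥′ {x₁} {q} per₁ hit₁ t r₁<p (m≤n+m (t * p) s))
                    (vanishingCount-≥ {x₂} {q} per₂ hit₂ t (+-monoˡ-< (t * p) r₂<s))))
  ... | no r₁≮s | no r₂≮s = widen {s} {t} 0 (subst (2 * s <_) (sym (*-identityˡ p)) 2s<p)
        (+-mono-≤ (vanishingCount-≥′ {x₁} {q} per₁ hit₁ t r₁<p (m≤n+m (t * p) s))
                  (vanishingCount-≥′ {x₂} {q} per₂ hit₂ t r₂<p (m≤n+m (t * p) s)))
    where
    2s<p : 2 * s < p
    2s<p = begin-strict
      2 * s          ≡⟨ double s ⟩
      s + s          ≤⟨ +-mono-≤ (≮⇒≥ r₁≮s) (≮⇒≥ r₂≮s) ⟩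
      r₁ + r₂        <⟨ n<1+n (r₁ + r₂) ⟩
      suc (r₁ + r₂)  ≡⟨ 1+r₁+r₂≡p ⟩
      p              ∎
      where
      open ≤-Reasoning
      double : ∀ s → 2 * s ≡ s + s
      double = solve-∀

module PochhammerPair (a b A B h k : ℕ) .{{_ : NonZero b}} .{{_ : NonZero k}}
                      (a≤b : a ≤ b) (A≤B : A ≤ B) (a⊥b : Coprime a b) (h⊥k : Coprime h k) where

  x₁ x₂ q : RootOfUnity
  x₁ = ζ b (+ a) · ζ k (+ (h * A))
  x₂ = ζ b (- (+ a)) · ζ k (+ (h * (B ∸ A)))
  q = ζ k (+ (h * B))

  m₁ m₂ : ℕ
  m₁ = a * (k / b) + h * A
  m₂ = (b ∸ a) * (k / b) + h * (B ∸ A)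

  Condition : Set
  Condition = b ∣ k × gcd B k ∣ (a * k) / b + h * A

  x₁-vanishes⇔ : ∀ j → FactorVanishes x₁ q j ⇔ (b ∣ k × k ∣ m₁ + j * (h * B))
  x₁-vanishes⇔ j =
    subst (λ n → FactorVanishes x₁ q j ⇔ (b ∣ k × k ∣ n))
          (sym (+-assoc (a * (k / b)) (h * A) (j * (h * B))))
          (b*k∣a*k+x*b⇔k∣a*[k/b]+x k _ a⊥b ⇔-∘ factorVanishes⁺⇔ a (h * A) (h * B) j)

  x₂-vanishes⇔ : ∀ j → FactorVanishes x₂ q j ⇔ (b ∣ k × k ∣ m₂ + j * (h * B))
  x₂-vanishes⇔ j =
    subst (λ n → FactorVanishes x₂ q j ⇔ (b ∣ k × k ∣ n))
          (sym (+-assoc ((b ∸ a) * (k / b)) (h * (B ∸ A)) (j * (h * B))))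
          (b*k∣a*k+x*b⇔k∣a*[k/b]+x k _ (coprime-∸ˡ a≤b a⊥b)
            ⇔-∘ factorVanishes⁻⇔ (h * (B ∸ A)) (h * B) j a≤b)

  m₁+m₂≡k+h*B : b ∣ k → m₁ + m₂ ≡ k + h * B
  m₁+m₂≡k+h*B b∣k = begin
    a * c + h * A + ((b ∸ a) * c + h * (B ∸ A))  ≡⟨ regroup a (b ∸ a) c h A (B ∸ A) ⟩
    (a + (b ∸ a)) * c + h * (A + (B ∸ A))        ≡⟨ cong₂ (λ u v → u * c + h * v)
                                                          (m+[n∸m]≡n a≤b) (m+[n∸m]≡n A≤B) ⟩
    b * c + h * B                                ≡⟨ cong (λ n → n + h * B)
                                                          (trans (*-comm b c) (m/n*n≡m b∣k)) ⟩
    k + h * B                                    ∎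
    where
    open ≡-Reasoning
    c = k / b
    regroup : ∀ a a′ c h A A′ → a * c + h * A + (a′ * c + h * A′) ≡ (a + a′) * c + h * (A + A′)
    regroup = solve-∀

  condition⇔ : Condition ⇔ (b ∣ k × gcd B k ∣ m₁)
  condition⇔ = mk⇔ (λ (b∣k , g∣) → b∣k , subst (gcd B k ∣_) (≡m₁ b∣k) g∣)
                   (λ (b∣k , g∣) → b∣k , subst (gcd B k ∣_) (sym (≡m₁ b∣k)) g∣)
    where
    ≡m₁ : b ∣ k → (a * k) / b + h * A ≡ m₁
    ≡m₁ b∣k = cong (λ n → n + h * A) (*-/-assoc a b∣k)

  gcd∣m : ∀ {m} j → k ∣ m + j * (h * B) → gcd B k ∣ m
  gcd∣m {m} j = ∣m+j*d⇒∣m m j (gcd[m,n]∣n B k) (∣n⇒∣m*n h (gcd[m,n]∣m B k))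

  gcd∣m₂⇒gcd∣m₁ : b ∣ k → gcd B k ∣ m₂ → gcd B k ∣ m₁
  gcd∣m₂⇒gcd∣m₁ b∣k g∣m₂ = ∣m+n∣m⇒∣n (subst (gcd B k ∣_) m₂+m₁≡k+h*B g∣k+h*B) g∣m₂
    where
    m₂+m₁≡k+h*B : k + h * B ≡ m₂ + m₁
    m₂+m₁≡k+h*B = sym (trans (+-comm m₂ m₁) (m₁+m₂≡k+h*B b∣k))
    g∣k+h*B : gcd B k ∣ k + h * B
    g∣k+h*B = ∣m∣n⇒∣m+n (gcd[m,n]∣n B k) (∣n⇒∣m*n h (gcd[m,n]∣m B k))

  vanishing⇒condition : PochInfZero x₁ q ⊎ PochInfZero x₂ q → Condition
  vanishing⇒condition (inj₁ (j , fv)) with Equivalence.to (x₁-vanishes⇔ j) fv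
  ... | b∣k , k∣ = Equivalence.from condition⇔ (b∣k , gcd∣m j k∣)
  vanishing⇒condition (inj₂ (j , fv)) with Equivalence.to (x₂-vanishes⇔ j) fv
  ... | b∣k , k∣ = Equivalence.from condition⇔ (b∣k , gcd∣m₂⇒gcd∣m₁ b∣k (gcd∣m j k∣))

  condition⇒solvable : Condition → b ∣ k × ∃ λ j → k ∣ m₁ + j * (h * B)
  condition⇒solvable c with Equivalence.to condition⇔ c
  ... | b∣k , g∣m₁ = b∣k , solveCongruence (∣-trans (coprime⇒gcd[h*B,k]∣gcd[B,k] h B h⊥k) g∣m₁)

  condition⇒vanishing : Condition → PochInfZero x₁ q
  condition⇒vanishing c with condition⇒solvable c
  ... | b∣k , j , k∣m₁+j*hB = j , Equivalence.from (x₁-vanishes⇔ j) (b∣k , k∣m₁+j*hB)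

  periodic : ∀ x {m p} → (∀ j → FactorVanishes x q j ⇔ (b ∣ k × k ∣ m + j * (h * B))) →
             k ∣ p * (h * B) → ∀ i → FactorVanishes x q i → FactorVanishes x q (i + p)
  periodic x {p = p} vanishes⇔ k∣p*hB i fv with Equivalence.to (vanishes⇔ i) fv
  ... | b∣k , k∣ = Equivalence.from (vanishes⇔ (i + p)) (b∣k , ∣m+i*d⇒∣m+[i+p]*d i k∣p*hB k∣)

  condition⇒vanishingCount-≥ : Condition → ∀ n →
    (2 * n + 2) /kPrime[ k , B ] ≤ vanishingCount x₁ q (suc n) + vanishingCount x₂ q (suc n)
  condition⇒vanishingCount-≥ c n with condition⇒solvable c
  ... | b∣k , j , k∣m₁+j*hB =
    subst (λ N → N / p ≤ vanishingCount x₁ q (suc n) + vanishingCount x₂ q (suc n))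
          (trans (*-suc 2 n) (+-comm 2 (2 * n)))
          (vanishingCount-pair-≥ {x₁} {x₂} {q} (periodic x₁ x₁-vanishes⇔ k∣p*hB)
                                 (periodic x₂ x₂-vanishes⇔ k∣p*hB) hit₁ hit₂ 1+r+[p∸1+r]≡p (suc n))
    where
    p = kPrime k B
    instance _ = kPrimeNZ k B
    k∣p*hB : k ∣ p * (h * B)
    k∣p*hB = subst (k ∣_) (x∙yz≈y∙xz h p B) (∣n⇒∣m*n h (k∣kPrime*B k B))
    r = j % p
    1+r+[p∸1+r]≡p : suc (r + (p ∸ suc r)) ≡ p
    1+r+[p∸1+r]≡p = m+[n∸m]≡n (m%n<n j p)
    k∣m₁+r*hB : k ∣ m₁ + r * (h * B)
    k∣m₁+r*hB = ∣m+i*d⇒∣m+[i%p]*d {p = p} j k∣p*hB k∣m₁+j*hB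
    hit₁ : FactorVanishes x₁ q r
    hit₁ = Equivalence.from (x₁-vanishes⇔ r) (b∣k , k∣m₁+r*hB)
    hit₂ : FactorVanishes x₂ q (p ∸ suc r)
    hit₂ = Equivalence.from (x₂-vanishes⇔ (p ∸ suc r))
             (b∣k , ∣m+r*d⇒∣m′+s*d {m = m₁} {m₂} {r = r} {p ∸ suc r}
                      (m₁+m₂≡k+h*B b∣k) k∣p*hB 1+r+[p∸1+r]≡p k∣m₁+r*hB)

lemma3p1 : (a b A B h k : ℕ) → .{{_ : NonZero b}} → .{{_ : NonZero B}} → .{{_ : NonZero k}} →
    a < b → A < B → h < k →
    gcd a b ≡ 1 → gcd A B ≡ 1 → gcd h k ≡ 1 →
    ((PochInfZero (ζ b (+ a) · ζ k (+ (h * A))) (ζ k (+ (h * B)))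
       ⊎ PochInfZero (ζ b (- (+ a)) · ζ k (+ (h * (B ∸ A)))) (ζ k (+ (h * B))))
      ⇔ (b ∣ k × gcd B k ∣ ((a * k) / b + h * A)))
    × ((b ∣ k × gcd B k ∣ ((a * k) / b + h * A)) →
       (n : ℕ) →
       (2 * n + 2) /kPrime[ k , B ]
         ≤ vanishingCount (ζ b (+ a) · ζ k (+ (h * A))) (ζ k (+ (h * B))) (suc n)
           + vanishingCount (ζ b (- (+ a)) · ζ k (+ (h * (B ∸ A)))) (ζ k (+ (h * B))) (suc n))
lemma3p1 a b A B h k a<b A<B _ gcd[a,b]≡1 _ gcd[h,k]≡1 =
  mk⇔ vanishing⇒condition (inj₁ ∘ condition⇒vanishing) , condition⇒vanishingCount-≥
  where
  open PochhammerPair a b A B h k (<⇒≤ a<b) (<⇒≤ A<B)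
                      (gcd≡1⇒coprime gcd[a,b]≡1) (gcd≡1⇒coprime gcd[h,k]≡1)
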